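{- Let $\mathcal{P}$ be the regular $n$-simplex or the $n$-cube, and let $W$ be the corresponding symmetry group ($A_n$ or $B_n$) with degree sequence $(d_i)_{i=1}^n$. Fix a flag $(\mathcal{P}_i^{\mathrm{std}})_{i=0}^n$ in $\mathcal{P}$ and set $T_i=T_{\mathcal{P}_i^{\mathrm{std}}}$. Then for all $i\in[1,n]$, $|T_i - T_{i-1}| = d_i - 1$.
   Context: The regular $n$-simplex is the convex hull of the standard basis of $\mathbb{R}^{n+1}$ with symmetry group $A_n\cong S_{n+1}$; the $n$-cube is the convex hull of $\{ -1,1\}^n$ with symmetry group the hyperoctahedral group $B_n$. The degree sequence of $A_n$ is $d_i=i+1$ and of $B_n$ is $d_i=2i$ ($i=1,\dots,n$). A (complete) flag $(\mathcal{P}_i)_{i=0}^n$ in $\mathcal{P}$ is a chain of faces $\mathcal{P}_0\subset\mathcal{P}_1\subset\cdots\subset\mathcal{P}_n=\mathcal{P}$ with $\dim\mathcal{P}_i=i$. For an $i$-face $F$ of $\mathcal{P}$, every reflective symmetry of $F$ extends uniquely to a reflective symmetry of $\mathcal{P}$; $T_F\subseteq W$ denotes the image of the set of reflections of $F$ under this extension. (For a $0$-face, $T_F=\emptyset$.) -}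

module Defs where

open import Data.Nat using (ℕ; zero; suc; _∸_) renaming (_+_ to _+ℕ_; _*_ to _*ℕ_)
open import Data.Integer using (ℤ; _+_; _*_; _-_; 0ℤ; 1ℤ; -1ℤ; +_)
open import Data.Sign using (Sign) renaming (+ to plus; - to minus)
open import Data.Fin using (Fin; zero; suc; inject₁; toℕ; _≟_)
open import Data.Fin.Subset using (Subset; _∈_; ∣_∣)
open import Data.Vec using (Vec; lookup)
open import Data.List using (List; length)
open import Data.List.Relation.Unary.All using (All)
open import Data.List.Relation.Unary.Unique.Propositional using (Unique)
import Data.List.Membership.Propositional as LM
open import Data.Product using (Σ; ∃; _×_)
open import Data.Sum using (_⊎_)
open import Relation.Nullary using (¬_; yes; no)
open import Relation.Binary.PropositionalEquality using (_≡_; _≢_)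

-- Linear algebra on ℤ^m (points of ℝ^m with integer coordinates suffice:
-- the vertices of both polytopes and the reflecting vectors are integral)

Pt : ℕ → Set
Pt m = Fin m → ℤ

dot : ∀ {m} → Pt m → Pt m → ℤ
dot {zero}  v w = 0ℤ
dot {suc m} v w = v zero * w zero + dot {m} (λ j → v (suc j)) (λ j → w (suc j))

e : ∀ {m} → Fin m → Pt m
e a j with j ≟ a
... | yes _ = 1ℤ
... | no  _ = 0ℤ

sgn : Sign → ℤ
sgn plus  = 1ℤ
sgn minus = -1ℤ

record SPerm (m : ℕ) : Set where
  constructor sperm
  field
    σ : Vec (Fin m) m
    ε : Vec Sign m
open SPerm public

act : ∀ {m} → SPerm m → Pt m → Pt m
act g x j = sgn (lookup (ε g) j) * x (lookup (σ g) j)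

IsPerm : ∀ {m} → SPerm m → Set
IsPerm {m} g = ∀ (i j : Fin m) → lookup (σ g) i ≡ lookup (σ g) j → i ≡ j

InB : ∀ {m} → SPerm m → Set
InB g = IsPerm g

-- the symmetric group S_m = A_{m-1} : permutation matrices (all signs +)
InA : ∀ {m} → SPerm m → Set
InA {m} g = IsPerm g × (∀ (j : Fin m) → lookup (ε g) j ≡ plus)

IsReflection : ∀ {m} → SPerm m → Set
IsReflection {m} g =
  Σ (Pt m) λ v → (dot v v ≢ 0ℤ) ×
    (∀ (x : Pt m) (j : Fin m) →
       dot v v * act g x j ≡ dot v v * x j - (+ 2) * dot v x * v j)

-- T_F for a face F given by its vertex set (a predicate on points).
-- A reflection r of W lies in T_F iff r stabilises F and restricts to a
-- non-trivial (hence reflective) symmetry of F.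

Stabilises : ∀ {m} → (Pt m → Set) → SPerm m → Set
Stabilises V g = ∀ x → V x → V (act g x)

ActsNontrivially : ∀ {m} → (Pt m → Set) → SPerm m → Set
ActsNontrivially {m} V g = Σ (Pt m) λ x → V x × Σ (Fin m) λ j → act g x j ≢ x j

T : ∀ {m} → (SPerm m → Set) → (Pt m → Set) → SPerm m → Set
T W V g = W g × IsReflection g × Stabilises V g × ActsNontrivially V g

-- P has exactly k elements (elements of W are concrete data, compared by ≡)
HasCard : ∀ {m} → (SPerm m → Set) → ℕ → Set
HasCard {m} P k = Σ (List (SPerm m)) λ xs →
  (length xs ≡ k) × Unique xs × All P xs × (∀ g → P g → g LM.∈ xs)

-- The regular n-simplex = conv(e_0,…,e_n) ⊂ ℝ^{n+1}.
-- Its faces are conv{e_a : a ∈ S} for nonempty S; dim = |S| - 1.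

SimplexVert : ∀ {m} → Subset m → Pt m → Set
SimplexVert {m} S x = Σ (Fin m) λ a → a ∈ S × (∀ j → x j ≡ e a j)

IsSimplexFlag : (n : ℕ) → (Fin (suc n) → Subset (suc n)) → Set
IsSimplexFlag n F =
  (∀ (i : Fin (suc n)) → ∣ F i ∣ ≡ suc (toℕ i)) ×
  (∀ (k : Fin n) x → SimplexVert (F (inject₁ k)) x → SimplexVert (F (suc k)) x)

-- The n-cube = conv({-1,1}^n).  A face fixes some coordinates to ±1 and
-- leaves the others free; dim = number of free coordinates.

data CubeCoord : Set where
  free : CubeCoord
  fix  : Sign → CubeCoord

CubeFace : ℕ → Set
CubeFace n = Fin n → CubeCoord

CubeVert : ∀ {n} → CubeFace n → Pt n → Set
CubeVert F x = ∀ j → (x j ≡ 1ℤ ⊎ x j ≡ -1ℤ) × (∀ s → F j ≡ fix s → x j ≡ sgn s)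

numFree : ∀ {n} → CubeFace n → ℕ
numFree {zero}  F = 0
numFree {suc n} F with F zero
... | free  = suc (numFree {n} (λ j → F (suc j)))
... | fix _ = numFree {n} (λ j → F (suc j))

IsCubeFlag : (n : ℕ) → (Fin (suc n) → CubeFace n) → Set
IsCubeFlag n F =
  (∀ (i : Fin (suc n)) → numFree (F i) ≡ toℕ i) ×
  (∀ (k : Fin n) x → CubeVert (F (inject₁ k)) x → CubeVert (F (suc k)) x)

degA : ℕ → ℕ
degA i = i +ℕ 1

degB : ℕ → ℕ
degB i = 2 *ℕ i

{-# OPTIONS --safe #-}
-- Every reflection g in a group of signed permutation matrices is a signed swap: x_a ↔ s·x_b
-- with a ≠ b, or the flip x_a ↦ −x_a.  Evaluating g x = x − 2⟨v,x⟩/⟨v,v⟩·v at the basis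
-- vectors shows that the matrix of g is symmetric and that row j is an identity row whenever
-- v_j = 0, so g is pinned down by the row of a coordinate j₀ with v_{j₀} ≠ 0.
-- A reflection of W lies in T_F exactly when the coordinates it moves index vertices of F
-- (simplex) or free coordinates of F (cube).  Consecutive faces of a flag differ by one new
-- coordinate c, so T_i − T_{i−1} consists of the reflections of W that move c and possibly one
-- old coordinate b: the transpositions (c b) for the i old vertices b of the simplex face, and
-- c ↦ −c together with c ↔ ±b for the i − 1 old free coordinates of the cube face.
module Submission where

open import Defs
open import Data.Bool using (Bool)
open import Data.Nat as ℕ using (ℕ; zero; suc; _∸_)
import Data.Nat.Properties as ℕ
open import Data.Integer using (ℤ; _+_; _*_; _-_; 0ℤ; 1ℤ; -1ℤ; +_; ≢-nonZero)
import Data.Integer.Properties as ℤ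
open import Data.Integer.Tactic.RingSolver using (solve-∀)
open import Data.Sign using (Sign; opposite) renaming (+ to plus; - to minus; _*_ to _⊛_)
open import Data.Fin using (Fin; zero; suc; _≟_; toℕ; inject₁)
open import Data.Fin.Properties using (suc-injective; toℕ-inject₁; ¬∀⟶∃¬)
open import Data.Fin.Subset using (Subset; _∈_; _∉_; _⊆_; _⊂_; ∣_∣; inside; outside; _∪_; ⁅_⁆)
open import Data.Fin.Subset.Properties
  using (_∈?_; p⊆q⇒∣p∣≤∣q∣; p⊂q⇒∣p∣<∣q∣; p⊆p∪q; x∈p∪q⁺; x∈p∪q⁻; x∈⁅x⁆; x∈⁅y⁆⇒x≡y)
open import Data.Vec using (Vec; []; _∷_; lookup; tabulate; here; there)
open import Data.Vec.Properties using (lookup∘tabulate; tabulate∘lookup; tabulate-cong; []=⇒lookup; lookup⇒[]=)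
open import Data.Vec.Functional using (updateAt)
open import Data.Vec.Functional.Properties using (updateAt-updates; updateAt-minimal)
open import Data.List using (List; []; _∷_; map; length; _++_)
open import Data.List.Properties using (length-map; length-++)
import Data.List.Relation.Unary.All as All
import Data.List.Relation.Unary.Any as Any
open import Data.List.Relation.Unary.AllPairs using ([]; _∷_)
open import Data.List.Relation.Unary.Unique.Propositional using (Unique)
open import Data.List.Relation.Unary.Unique.Propositional.Properties using (map⁺; ++⁺)
open import Data.List.Membership.Propositional using () renaming (_∈_ to _∈ₗ_)
open import Data.List.Membership.Propositional.Properties using (∈-map⁺; ∈-map⁻; ∈-++⁺ˡ; ∈-++⁺ʳ; ∈-++⁻)
open import Data.Product using (∃; ∃₂; _×_; _,_; proj₁; proj₂; uncurry)
open import Data.Product.Properties using (,-injectiveˡ; ,-injectiveʳ)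
open import Data.Product.Function.NonDependent.Propositional using (_×-⇔_)
open import Data.Sum using (_⊎_; inj₁; inj₂; [_,_]′)
open import Function using (_∘_; case_of_)
open import Function.Bundles using (_⇔_; mk⇔; Equivalence)
open import Function.Properties.Equivalence using () renaming (sym to ⇔-sym)
open import Function.Related.TypeIsomorphisms using (¬-cong-⇔)
open import Relation.Nullary using (¬_; yes; no)
open import Relation.Nullary.Decidable using (decidable-stable; _→-dec_)
open import Relation.Nullary.Negation using (contradiction)
open import Relation.Binary.PropositionalEquality
open ≡-Reasoning
open Equivalence using (to; from)

e-diag : ∀ {m} (a : Fin m) → e a a ≡ 1ℤ
e-diag a with a ≟ a
... | yes _  = refl
... | no a≢a = contradiction refl a≢a

e-offdiag : ∀ {m} {a j : Fin m} → j ≢ a → e a j ≡ 0ℤ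
e-offdiag {a = a} {j} j≢a with j ≟ a
... | yes j≡a = contradiction j≡a j≢a
... | no _    = refl

e-sym : ∀ {m} (a j : Fin m) → e a j ≡ e j a
e-sym a j = case j ≟ a of λ where
  (yes refl) → refl
  (no j≢a)   → trans (e-offdiag j≢a) (sym (e-offdiag (j≢a ∘ sym)))

e-injective : ∀ {m} {a b : Fin m} → (∀ j → e a j ≡ e b j) → a ≡ b
e-injective {a = a} {b} ea≗eb with a ≟ b
... | yes a≡b = a≡b
... | no a≢b  = contradiction (trans (sym (e-diag a)) (trans (ea≗eb a) (e-offdiag a≢b))) λ ()

e-involution : ∀ {m} {f : Fin m → Fin m} → (∀ i → f (f i) ≡ i) → ∀ d j → e d (f j) ≡ e (f d) j
e-involution {f = f} f-inv d j = case j ≟ f d of λ where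
  (yes refl) → trans (cong (e d) (f-inv d)) (trans (e-diag d) (sym (e-diag (f d))))
  (no j≢fd)  → trans (e-offdiag λ fj≡d → j≢fd (trans (sym (f-inv j)) (cong f fj≡d))) (sym (e-offdiag j≢fd))

dot-comm : ∀ {m} (v w : Pt m) → dot v w ≡ dot w v
dot-comm {zero}  v w = refl
dot-comm {suc m} v w = cong₂ _+_ (ℤ.*-comm (v zero) (w zero)) (dot-comm (v ∘ suc) (w ∘ suc))

dot-zeroʳ : ∀ {m} (v w : Pt m) → (∀ j → w j ≡ 0ℤ) → dot v w ≡ 0ℤ
dot-zeroʳ {zero}  v w w≗0 = refl
dot-zeroʳ {suc m} v w w≗0 = begin
  v zero * w zero + dot (v ∘ suc) (w ∘ suc) ≡⟨ cong₂ (λ y z → v zero * y + z) (w≗0 zero) (dot-zeroʳ (v ∘ suc) (w ∘ suc) (w≗0 ∘ suc)) ⟩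
  v zero * 0ℤ + 0ℤ                         ≡⟨ trans (ℤ.+-identityʳ (v zero * 0ℤ)) (ℤ.*-zeroʳ (v zero)) ⟩
  0ℤ                                        ∎

dot-supported : ∀ {m} (v w : Pt m) (a : Fin m) → (∀ j → j ≢ a → w j ≡ 0ℤ) → dot v w ≡ v a * w a
dot-supported v w zero w≗0 = begin
  v zero * w zero + dot (v ∘ suc) (w ∘ suc) ≡⟨ cong (λ z → v zero * w zero + z) (dot-zeroʳ (v ∘ suc) (w ∘ suc) (λ j → w≗0 (suc j) λ ())) ⟩
  v zero * w zero + 0ℤ                      ≡⟨ ℤ.+-identityʳ _ ⟩
  v zero * w zero                           ∎
dot-supported v w (suc a) w≗0 = begin
  v zero * w zero + dot (v ∘ suc) (w ∘ suc) ≡⟨ cong₂ (λ y z → v zero * y + z) (w≗0 zero λ ()) (dot-supported (v ∘ suc) (w ∘ suc) a λ j j≢a → w≗0 (suc j) (j≢a ∘ suc-injective)) ⟩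
  v zero * 0ℤ + v (suc a) * w (suc a)       ≡⟨ trans (cong (_+ v (suc a) * w (suc a)) (ℤ.*-zeroʳ (v zero))) (ℤ.+-identityˡ (v (suc a) * w (suc a))) ⟩
  v (suc a) * w (suc a)                     ∎

dot-eʳ : ∀ {m} (v : Pt m) (a : Fin m) → dot v (e a) ≡ v a
dot-eʳ v a = trans (dot-supported v (e a) a λ _ → e-offdiag) (trans (cong (v a *_) (e-diag a)) (ℤ.*-identityʳ (v a)))

dot-eˡ : ∀ {m} (v : Pt m) (a : Fin m) → dot (e a) v ≡ v a
dot-eˡ v a = trans (dot-comm (e a) v) (dot-eʳ v a)

dot-linearˡ : ∀ {m} (u w x : Pt m) (k : ℤ) → dot (λ j → u j - k * w j) x ≡ dot u x - k * dot w x
dot-linearˡ {zero}  u w x k = sym (cong (0ℤ -_) (ℤ.*-zeroʳ k))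
dot-linearˡ {suc m} u w x k =
  trans (cong (λ z → (u zero - k * w zero) * x zero + z) (dot-linearˡ (u ∘ suc) (w ∘ suc) (x ∘ suc) k))
        (regroup (u zero) (w zero) (x zero) k _ _)
  where
  regroup : ∀ u₀ w₀ x₀ k U W → (u₀ - k * w₀) * x₀ + (U - k * W) ≡ (u₀ * x₀ + U) - k * (w₀ * x₀ + W)
  regroup = solve-∀

row : ∀ {m} → SPerm m → Fin m → Fin m × Sign
row g j = lookup (σ g) j , lookup (ε g) j

fromRows : ∀ {m} → (Fin m → Fin m × Sign) → SPerm m
fromRows r = sperm (tabulate (proj₁ ∘ r)) (tabulate (proj₂ ∘ r))

row-fromRows : ∀ {m} (r : Fin m → Fin m × Sign) j → row (fromRows r) j ≡ r j
row-fromRows r j = cong₂ _,_ (lookup∘tabulate (proj₁ ∘ r) j) (lookup∘tabulate (proj₂ ∘ r) j)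

row-ext : ∀ {m} {g h : SPerm m} → (∀ j → row g j ≡ row h j) → g ≡ h
row-ext {g = sperm σ₁ ε₁} {sperm σ₂ ε₂} rows =
  cong₂ sperm (lookup-ext (cong proj₁ ∘ rows)) (lookup-ext (cong proj₂ ∘ rows))
  where
  lookup-ext : ∀ {A : Set} {m} {xs ys : Vec A m} → (∀ j → lookup xs j ≡ lookup ys j) → xs ≡ ys
  lookup-ext {xs = xs} {ys} xs≗ys =
    trans (sym (tabulate∘lookup xs)) (trans (tabulate-cong xs≗ys) (tabulate∘lookup ys))

act-row : ∀ {m} (g : SPerm m) (x : Pt m) {i j : Fin m} {t : Sign} → row g j ≡ (i , t) → act g x j ≡ sgn t * x i
act-row g x = cong λ (i , t) → sgn t * x i

swapRow : ∀ {m} → Sign → Fin m → Fin m → Fin m → Fin m × Sign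
swapRow s a b j with j ≟ a | j ≟ b
... | yes _ | _     = b , s
... | no _  | yes _ = a , s
... | no _  | no _  = j , plus

-- x ↦ x with x_a, x_b replaced by s·x_b, s·x_a; for a = b this is x_a ↦ s·x_a.
signedSwap : ∀ {m} → Sign → Fin m → Fin m → SPerm m
signedSwap s a b = fromRows (swapRow s a b)

signedSwap-elim : ∀ {m ℓ} (P : Fin m → Fin m × Sign → Set ℓ) {s} {a b : Fin m} →
                  P a (b , s) → P b (a , s) → (∀ j → j ≢ a → j ≢ b → P j (j , plus)) →
                  ∀ j → P j (row (signedSwap s a b) j)
signedSwap-elim P {s} {a} {b} Pa Pb Pj j = subst (P j) (sym (row-fromRows (swapRow s a b) j)) (elim j)
  where
  elim : ∀ j → P j (swapRow s a b j)
  elim j with j ≟ a | j ≟ b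
  ... | yes refl | _        = Pa
  ... | no _     | yes refl = Pb
  ... | no j≢a   | no j≢b   = Pj j j≢a j≢b

module _ {m} {s : Sign} {a b : Fin m} where

  row-signedSwap-a : row (signedSwap s a b) a ≡ (b , s)
  row-signedSwap-a = signedSwap-elim (λ j r → j ≡ a → r ≡ (b , s))
    (λ _ → refl) (λ b≡a → cong (_, s) (sym b≡a)) (λ _ j≢a _ j≡a → contradiction j≡a j≢a) a refl

  row-signedSwap-b : row (signedSwap s a b) b ≡ (a , s)
  row-signedSwap-b = signedSwap-elim (λ j r → j ≡ b → r ≡ (a , s))
    (λ a≡b → cong (_, s) (sym a≡b)) (λ _ → refl) (λ _ _ j≢b j≡b → contradiction j≡b j≢b) b refl

  row-signedSwap-other : ∀ {j} → j ≢ a → j ≢ b → row (signedSwap s a b) j ≡ (j , plus)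
  row-signedSwap-other {j} j≢a j≢b = signedSwap-elim (λ i r → i ≢ a → i ≢ b → r ≡ (i , plus))
    (λ a≢a _ → contradiction refl a≢a) (λ _ b≢b → contradiction refl b≢b) (λ _ _ _ _ _ → refl) j j≢a j≢b

≡signedSwap : ∀ {m} {g : SPerm m} {s a b} → row g a ≡ (b , s) → row g b ≡ (a , s) →
              (∀ j → j ≢ a → j ≢ b → row g j ≡ (j , plus)) → g ≡ signedSwap s a b
≡signedSwap {g = g} ga gb gj = row-ext (signedSwap-elim (λ j r → row g j ≡ r) ga gb gj)

signedSwap-comm : ∀ {m} s (a b : Fin m) → signedSwap s a b ≡ signedSwap s b a
signedSwap-comm s a b = ≡signedSwap row-signedSwap-b row-signedSwap-a
  λ _ j≢b j≢a → row-signedSwap-other j≢a j≢b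

σ-signedSwap-involutive : ∀ {m} s (a b : Fin m) j →
                          let τ = lookup (σ (signedSwap s a b)) in τ (τ j) ≡ j
σ-signedSwap-involutive s a b = signedSwap-elim (λ j r → lookup (σ (signedSwap s a b)) (proj₁ r) ≡ j)
  (cong proj₁ row-signedSwap-b) (cong proj₁ row-signedSwap-a)
  (λ _ j≢a j≢b → cong proj₁ (row-signedSwap-other j≢a j≢b))

signedSwap-isPerm : ∀ {m} s (a b : Fin m) → IsPerm (signedSwap s a b)
signedSwap-isPerm s a b i j τi≡τj =
  trans (sym (σ-signedSwap-involutive s a b i))
        (trans (cong (lookup (σ (signedSwap s a b))) τi≡τj) (σ-signedSwap-involutive s a b j))

-- Reflections among signed permutations

Reflecting : ∀ {m} → Sign → Fin m → Fin m → Set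
Reflecting s a b = a ≡ b → s ≡ minus

flip-isReflection : ∀ {m} (a : Fin m) → IsReflection (signedSwap minus a a)
flip-isReflection a = e a , (λ ‖ea‖≡0 → contradiction (trans (sym ‖ea‖≡1) ‖ea‖≡0) λ ()) , reflects
  where
  ‖ea‖≡1 : dot (e a) (e a) ≡ 1ℤ
  ‖ea‖≡1 = trans (dot-eʳ (e a) a) (e-diag a)
  negated : ∀ y → 1ℤ * (-1ℤ * y) ≡ 1ℤ * y - + 2 * y * 1ℤ
  negated = solve-∀
  fixed : ∀ y z → 1ℤ * (1ℤ * y) ≡ 1ℤ * y - + 2 * z * 0ℤ
  fixed = solve-∀
  reflects : ∀ x j → dot (e a) (e a) * act (signedSwap minus a a) x j ≡
                     dot (e a) (e a) * x j - + 2 * dot (e a) x * e a j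
  reflects x j rewrite ‖ea‖≡1 | dot-eˡ x a =
    signedSwap-elim (λ j (i , t) → 1ℤ * (sgn t * x i) ≡ 1ℤ * x j - + 2 * x a * e a j) at-a at-a
      (λ j j≢a _ → trans (fixed (x j) (x a)) (cong (λ y → 1ℤ * x j - + 2 * x a * y) (sym (e-offdiag j≢a)))) j
    where
    at-a : 1ℤ * (-1ℤ * x a) ≡ 1ℤ * x a - + 2 * x a * e a a
    at-a = trans (negated (x a)) (cong (λ y → 1ℤ * x a - + 2 * x a * y) (sym (e-diag a)))

transposition-isReflection : ∀ {m} s {a b : Fin m} → a ≢ b → IsReflection (signedSwap s a b)
transposition-isReflection {m} s {a} {b} a≢b =
  v , (λ ‖v‖≡0 → contradiction (trans (sym ‖v‖≡2) ‖v‖≡0) λ ()) , reflects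
  where
  v : Pt m
  v j = e a j - sgn s * e b j
  dot-v : ∀ x → dot v x ≡ x a - sgn s * x b
  dot-v x = trans (dot-linearˡ (e a) (e b) x (sgn s)) (cong₂ (λ y z → y - sgn s * z) (dot-eˡ x a) (dot-eˡ x b))
  v-a : v a ≡ 1ℤ - sgn s * 0ℤ
  v-a = cong₂ (λ y z → y - sgn s * z) (e-diag a) (e-offdiag a≢b)
  v-b : v b ≡ 0ℤ - sgn s * 1ℤ
  v-b = cong₂ (λ y z → y - sgn s * z) (e-offdiag (a≢b ∘ sym)) (e-diag b)
  v-other : ∀ {j} → j ≢ a → j ≢ b → v j ≡ 0ℤ - sgn s * 0ℤ
  v-other j≢a j≢b = cong₂ (λ y z → y - sgn s * z) (e-offdiag j≢a) (e-offdiag j≢b)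
  sgn² : ∀ s → (1ℤ - sgn s * 0ℤ) - sgn s * (0ℤ - sgn s * 1ℤ) ≡ + 2
  sgn² plus  = refl
  sgn² minus = refl
  ‖v‖≡2 : dot v v ≡ + 2
  ‖v‖≡2 = trans (dot-v v) (trans (cong₂ (λ y z → y - sgn s * z) v-a v-b) (sgn² s))
  at-a : ∀ k xa xb → + 2 * (k * xb) ≡ + 2 * xa - + 2 * (xa - k * xb) * (1ℤ - k * 0ℤ)
  at-a = solve-∀
  at-b : ∀ s xa xb → + 2 * (sgn s * xa) ≡ + 2 * xb - + 2 * (xa - sgn s * xb) * (0ℤ - sgn s * 1ℤ)
  at-b plus  = solve-∀
  at-b minus = solve-∀
  elsewhere : ∀ k xa xb xj → + 2 * (1ℤ * xj) ≡ + 2 * xj - + 2 * (xa - k * xb) * (0ℤ - k * 0ℤ)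
  elsewhere = solve-∀
  reflects : ∀ x j → dot v v * act (signedSwap s a b) x j ≡ dot v v * x j - + 2 * dot v x * v j
  reflects x j rewrite ‖v‖≡2 | dot-v x =
    signedSwap-elim (λ j (i , t) → + 2 * (sgn t * x i) ≡ + 2 * x j - + 2 * (x a - sgn s * x b) * v j)
      (trans (at-a (sgn s) (x a) (x b)) (cong (λ y → + 2 * x a - + 2 * (x a - sgn s * x b) * y) (sym v-a)))
      (trans (at-b s (x a) (x b)) (cong (λ y → + 2 * x b - + 2 * (x a - sgn s * x b) * y) (sym v-b)))
      (λ j j≢a j≢b → trans (elsewhere (sgn s) (x a) (x b) (x j))
                           (cong (λ y → + 2 * x j - + 2 * (x a - sgn s * x b) * y) (sym (v-other j≢a j≢b)))) j

signedSwap-isReflection : ∀ {m} {s} {a b : Fin m} → Reflecting s a b → IsReflection (signedSwap s a b)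
signedSwap-isReflection {s = s} {a} {b} reflecting with a ≟ b
... | no a≢b   = transposition-isReflection s a≢b
... | yes refl with reflecting refl
...   | refl = flip-isReflection a

sgn≢0 : ∀ s → sgn s ≢ 0ℤ
sgn≢0 plus  ()
sgn≢0 minus ()

sgn-injective : ∀ {s t} → sgn s ≡ sgn t → s ≡ t
sgn-injective {plus}  {plus}  _ = refl
sgn-injective {minus} {minus} _ = refl

≢plus⇒≡minus : ∀ {s} → s ≢ plus → s ≡ minus
≢plus⇒≡minus {plus}  s≢plus = contradiction refl s≢plus
≢plus⇒≡minus {minus} _      = refl

sgn*e≡sgn : ∀ {m} {t u : Sign} {a i : Fin m} → sgn t * e a i ≡ sgn u → i ≡ a × t ≡ u
sgn*e≡sgn {t = t} {u} {a} {i} eq = case i ≟ a of λ where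
  (yes refl) → refl , sgn-injective (trans (sym (ℤ.*-identityʳ (sgn t))) (trans (cong (sgn t *_) (sym (e-diag a))) eq))
  (no i≢a)   → contradiction (trans (sym eq) (trans (cong (sgn t *_) (e-offdiag i≢a)) (ℤ.*-zeroʳ (sgn t))))
                             (sgn≢0 u)

2pq≡0⇔ : ∀ {p q} → + 2 * p * q ≡ 0ℤ ⇔ (p ≡ 0ℤ ⊎ q ≡ 0ℤ)
2pq≡0⇔ {p} {q} = mk⇔ factors product
  where
  factors : + 2 * p * q ≡ 0ℤ → p ≡ 0ℤ ⊎ q ≡ 0ℤ
  factors 2pq≡0 with ℤ.i*j≡0⇒i≡0∨j≡0 (+ 2 * p) 2pq≡0
  ... | inj₂ q≡0 = inj₂ q≡0
  ... | inj₁ 2p≡0 with ℤ.i*j≡0⇒i≡0∨j≡0 (+ 2) 2p≡0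
  ...   | inj₂ p≡0 = inj₁ p≡0
  product : p ≡ 0ℤ ⊎ q ≡ 0ℤ → + 2 * p * q ≡ 0ℤ
  product (inj₁ refl) = refl
  product (inj₂ refl) = ℤ.*-zeroʳ (+ 2 * p)

-- Entry (j, a) of a reflection matrix satisfies c·g_ja = c·δ_ja − 2·v_a·v_j with c = ⟨v,v⟩ ≠ 0.
module _ {c y z p q : ℤ} (c≢0 : c ≢ 0ℤ) (eq : c * y ≡ c * z - + 2 * p * q) where

  private
    2pq≡c[z-y] : + 2 * p * q ≡ c * (z - y)
    2pq≡c[z-y] = begin
      + 2 * p * q                   ≡⟨ w≡x-[x-w] (c * z) (+ 2 * p * q) ⟩
      c * z - (c * z - + 2 * p * q) ≡⟨ cong (λ t → c * z - t) (sym eq) ⟩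
      c * z - c * y                 ≡⟨ factor c y z ⟩
      c * (z - y)                   ∎
      where
      w≡x-[x-w] : ∀ x w → w ≡ x - (x - w)
      w≡x-[x-w] = solve-∀
      factor : ∀ c y z → c * z - c * y ≡ c * (z - y)
      factor = solve-∀

  ≡⇔factor≡0 : y ≡ z ⇔ (p ≡ 0ℤ ⊎ q ≡ 0ℤ)
  ≡⇔factor≡0 = mk⇔ (to 2pq≡0⇔ ∘ y≡z⇒2pq≡0) (2pq≡0⇒y≡z ∘ from 2pq≡0⇔)
    where
    y≡z⇒2pq≡0 : y ≡ z → + 2 * p * q ≡ 0ℤ
    y≡z⇒2pq≡0 y≡z = trans 2pq≡c[z-y] (trans (cong (c *_) (ℤ.i≡j⇒i-j≡0 (sym y≡z))) (ℤ.*-zeroʳ c))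
    2pq≡0⇒y≡z : + 2 * p * q ≡ 0ℤ → y ≡ z
    2pq≡0⇒y≡z 2pq≡0 = sym (ℤ.i-j≡0⇒i≡j z y (ℤ.*-cancelˡ-≡ c (z - y) 0ℤ {{≢-nonZero c≢0}}
                    (trans (sym 2pq≡c[z-y]) (trans 2pq≡0 (sym (ℤ.*-zeroʳ c))))))

module Classification {m} {g : SPerm m} (g-perm : IsPerm g) (v : Pt m) (‖v‖≢0 : dot v v ≢ 0ℤ)
  (reflects : ∀ x j → dot v v * act g x j ≡ dot v v * x j - + 2 * dot v x * v j) where

  entry : Fin m → Fin m → ℤ
  entry j a = act g (e a) j

  entry-equation : ∀ j a → dot v v * entry j a ≡ dot v v * e a j - + 2 * v a * v j
  entry-equation j a = trans (reflects (e a) j) (cong (λ y → dot v v * e a j - + 2 * y * v j) (dot-eʳ v a))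

  entry≡e⇔ : ∀ {j a} → entry j a ≡ e a j ⇔ (v a ≡ 0ℤ ⊎ v j ≡ 0ℤ)
  entry≡e⇔ {j} {a} = ≡⇔factor≡0 ‖v‖≢0 (entry-equation j a)

  entry-symmetric : ∀ j a → entry j a ≡ entry a j
  entry-symmetric j a = ℤ.*-cancelˡ-≡ (dot v v) (entry j a) (entry a j) {{≢-nonZero ‖v‖≢0}} (begin
    dot v v * entry j a               ≡⟨ entry-equation j a ⟩
    dot v v * e a j - + 2 * v a * v j ≡⟨ cong₂ (λ y z → dot v v * y - z) (e-sym a j) (swap-factors (v a) (v j)) ⟩
    dot v v * e j a - + 2 * v j * v a ≡⟨ sym (entry-equation a j) ⟩
    dot v v * entry a j               ∎)
    where
    swap-factors : ∀ p q → + 2 * p * q ≡ + 2 * q * p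
    swap-factors = solve-∀

  entry-at-σ : ∀ j → entry j (lookup (σ g) j) ≡ sgn (lookup (ε g) j)
  entry-at-σ j = trans (cong (sgn (lookup (ε g) j) *_) (e-diag _)) (ℤ.*-identityʳ _)

  entry≡sgn⇒row : ∀ {j a u} → entry j a ≡ sgn u → row g j ≡ (a , u)
  entry≡sgn⇒row entry≡sgn = uncurry (cong₂ _,_) (sgn*e≡sgn entry≡sgn)

  fixed-row : ∀ {j} → v j ≡ 0ℤ → row g j ≡ (j , plus)
  fixed-row {j} vj≡0 = entry≡sgn⇒row (trans (from entry≡e⇔ (inj₁ vj≡0)) (e-diag j))

  nonzero-coordinate : ∃ λ j → v j ≢ 0ℤ
  nonzero-coordinate = ¬∀⟶∃¬ m (λ j → v j ≡ 0ℤ) (λ j → v j ℤ.≟ 0ℤ) (‖v‖≢0 ∘ dot-zeroʳ v v)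

  j₀ : Fin m
  j₀ = proj₁ nonzero-coordinate

  v[j₀]≢0 : v j₀ ≢ 0ℤ
  v[j₀]≢0 = proj₂ nonzero-coordinate

  b : Fin m
  b = lookup (σ g) j₀

  s : Sign
  s = lookup (ε g) j₀

  v[b]≢0 : v b ≢ 0ℤ
  v[b]≢0 = case b ≟ j₀ of λ where
    (yes b≡j₀) → subst (λ i → v i ≢ 0ℤ) (sym b≡j₀) v[j₀]≢0
    (no b≢j₀)  → λ vb≡0 → sgn≢0 s (begin
      sgn s      ≡⟨ entry-at-σ j₀ ⟨
      entry j₀ b ≡⟨ from entry≡e⇔ (inj₁ vb≡0) ⟩
      e b j₀     ≡⟨ e-offdiag (b≢j₀ ∘ sym) ⟩
      0ℤ         ∎)

  reflecting : Reflecting s j₀ b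
  reflecting j₀≡b = ≢plus⇒≡minus λ s≡plus → [ v[b]≢0 , v[j₀]≢0 ]′ (to entry≡e⇔ (begin
    entry j₀ b ≡⟨ entry-at-σ j₀ ⟩
    sgn s      ≡⟨ cong sgn s≡plus ⟩
    1ℤ         ≡⟨ sym (e-diag b) ⟩
    e b b      ≡⟨ cong (e b) (sym j₀≡b) ⟩
    e b j₀     ∎))

  row-b : row g b ≡ (j₀ , s)
  row-b = case b ≟ j₀ of λ where
    (yes b≡j₀) → trans (cong (row g) b≡j₀) (cong (_, s) b≡j₀)
    (no b≢j₀)  → entry≡sgn⇒row (trans (entry-symmetric b j₀) (entry-at-σ j₀))

  other-rows : ∀ j → j ≢ j₀ → j ≢ b → row g j ≡ (j , plus)
  other-rows j j≢j₀ j≢b =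
    fixed-row ([ (λ vb≡0 → contradiction vb≡0 v[b]≢0) , (λ vj≡0 → vj≡0) ]′ (to entry≡e⇔ entry[j,b]≡e))
    where
    entry[j,b]≡e : entry j b ≡ e b j
    entry[j,b]≡e = trans (cong (sgn (lookup (ε g) j) *_) (e-offdiag (j≢j₀ ∘ g-perm j j₀)))
                     (trans (ℤ.*-zeroʳ (sgn (lookup (ε g) j))) (sym (e-offdiag j≢b)))

  isSignedSwap : g ≡ signedSwap s j₀ b
  isSignedSwap = ≡signedSwap refl row-b other-rows

reflection-classification : ∀ {m} {g : SPerm m} → IsPerm g → IsReflection g →
                            ∃ λ s → ∃₂ λ a b → Reflecting s a b × g ≡ signedSwap s a b
reflection-classification {g = g} perm (v , ‖v‖≢0 , reflects) = s , j₀ , b , reflecting , isSignedSwap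
  where open Classification {g = g} perm v ‖v‖≢0 reflects

elements : ∀ {n} → Subset n → List (Fin n)
elements []            = []
elements (inside  ∷ p) = zero ∷ map suc (elements p)
elements (outside ∷ p) = map suc (elements p)

length-elements : ∀ {n} (p : Subset n) → length (elements p) ≡ ∣ p ∣
length-elements []            = refl
length-elements (inside  ∷ p) = cong suc (trans (length-map suc (elements p)) (length-elements p))
length-elements (outside ∷ p) = trans (length-map suc (elements p)) (length-elements p)

elements-unique : ∀ {n} (p : Subset n) → Unique (elements p)
elements-unique []            = []
elements-unique (inside  ∷ p) = All.tabulate zero≢ ∷ map⁺ suc-injective (elements-unique p)
  where
  zero≢ : ∀ {x} → x ∈ₗ map suc (elements p) → zero ≢ x
  zero≢ x∈ refl with ∈-map⁻ suc x∈
  ... | _ , _ , ()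
elements-unique (outside ∷ p) = map⁺ suc-injective (elements-unique p)

∈-elements⁺ : ∀ {n} {p : Subset n} {x} → x ∈ p → x ∈ₗ elements p
∈-elements⁺ {p = inside  ∷ p} here        = Any.here refl
∈-elements⁺ {p = inside  ∷ p} (there x∈p) = Any.there (∈-map⁺ suc (∈-elements⁺ x∈p))
∈-elements⁺ {p = outside ∷ p} (there x∈p) = ∈-map⁺ suc (∈-elements⁺ x∈p)

∈-elements⁻ : ∀ {n} (p : Subset n) {x} → x ∈ₗ elements p → x ∈ p
∈-elements⁻ (inside ∷ p) (Any.here refl) = here
∈-elements⁻ (inside ∷ p) (Any.there x∈) with ∈-map⁻ suc x∈
... | _ , y∈ , refl = there (∈-elements⁻ p y∈)
∈-elements⁻ (outside ∷ p) x∈ with ∈-map⁻ suc x∈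
... | _ , y∈ , refl = there (∈-elements⁻ p y∈)

tagged : ∀ {n} → Sign → Subset n → List (Fin n × Sign)
tagged t p = map (_, t) (elements p)

∈-tagged⇔ : ∀ {n} {p : Subset n} {t s b} → (b , s) ∈ₗ tagged t p ⇔ (s ≡ t × b ∈ p)
∈-tagged⇔ {p = p} {t} = mk⇔ untag λ { (refl , b∈p) → ∈-map⁺ (_, t) (∈-elements⁺ b∈p) }
  where
  untag : ∀ {b s} → (b , s) ∈ₗ tagged t p → s ≡ t × b ∈ p
  untag x∈ with ∈-map⁻ (_, t) x∈
  ... | _ , b∈ , refl = refl , ∈-elements⁻ p b∈

tagged-unique : ∀ {n} (p : Subset n) t → Unique (tagged t p)
tagged-unique p t = map⁺ (cong proj₁) (elements-unique p)

length-tagged : ∀ {n} (p : Subset n) t → length (tagged t p) ≡ ∣ p ∣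
length-tagged p t = trans (length-map (_, t) (elements p)) (length-elements p)

record _⋖_ {n} (p q : Subset n) : Set where
  field
    p⊆q   : p ⊆ q
    new   : Fin n
    new∈q : new ∈ q
    new∉p : new ∉ p
    old   : ∀ {x} → x ∈ q → x ≢ new → x ∈ p

  new≢ : ∀ {x} → x ∈ p → new ≢ x
  new≢ x∈p new≡x = new∉p (subst (_∈ p) (sym new≡x) x∈p)

⊆∧∣q∣≡1+∣p∣⇒⋖ : ∀ {n} {p q : Subset n} → p ⊆ q → ∣ q ∣ ≡ suc ∣ p ∣ → p ⋖ q
⊆∧∣q∣≡1+∣p∣⇒⋖ {n} {p} {q} p⊆q ∣q∣≡ = record
  { p⊆q = p⊆q ; new = new ; new∈q = new∈q ; new∉p = new∉p ; old = old }
  where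
  q⊈p : ¬ (∀ x → x ∈ q → x ∈ p)
  q⊈p q⊆p = ℕ.1+n≰n (subst (ℕ._≤ ∣ p ∣) ∣q∣≡ (p⊆q⇒∣p∣≤∣q∣ (q⊆p _)))
  witness : ∃ λ x → ¬ (x ∈ q → x ∈ p)
  witness = ¬∀⟶∃¬ n (λ x → x ∈ q → x ∈ p) (λ x → x ∈? q →-dec x ∈? p) q⊈p
  new : Fin n
  new = proj₁ witness
  new∈q : new ∈ q
  new∈q = decidable-stable (new ∈? q) λ new∉q → proj₂ witness λ new∈q → contradiction new∈q new∉q
  new∉p : new ∉ p
  new∉p new∈p = proj₂ witness λ _ → new∈p
  old : ∀ {x} → x ∈ q → x ≢ new → x ∈ p
  -- Otherwise p ⊂ p ∪ ⁅ new ⁆ ⊂ q, so ∣ q ∣ would exceed ∣ p ∣ by at least two.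
  old {x} x∈q x≢new = decidable-stable (x ∈? p) λ x∉p →
    ℕ.<⇒≱ (p⊂q⇒∣p∣<∣q∣ p⊂p+new)
          (ℕ.≤-pred (subst (∣ p ∪ ⁅ new ⁆ ∣ ℕ.<_) ∣q∣≡ (p⊂q⇒∣p∣<∣q∣ (p+new⊆q , x , x∈q , x∉p+new x∉p))))
    where
    p⊂p+new : p ⊂ p ∪ ⁅ new ⁆
    p⊂p+new = p⊆p∪q ⁅ new ⁆ , new , x∈p∪q⁺ (inj₂ (x∈⁅x⁆ new)) , new∉p
    p+new⊆q : p ∪ ⁅ new ⁆ ⊆ q
    p+new⊆q y∈ = [ p⊆q , (λ y∈⁅new⁆ → subst (_∈ q) (sym (x∈⁅y⁆⇒x≡y new y∈⁅new⁆)) new∈q) ]′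
                   (x∈p∪q⁻ p ⁅ new ⁆ y∈)
    x∉p+new : x ∉ p → x ∉ p ∪ ⁅ new ⁆
    x∉p+new x∉p x∈ = [ x∉p , x≢new ∘ x∈⁅y⁆⇒x≡y new ]′ (x∈p∪q⁻ p ⁅ new ⁆ x∈)

HasCard-cong : ∀ {m} {P Q : SPerm m → Set} {k} → (∀ g → P g ⇔ Q g) → HasCard P k → HasCard Q k
HasCard-cong P⇔Q (xs , length≡k , unique , all-P , P⊆xs) =
  xs , length≡k , unique , All.map (λ {g} → to (P⇔Q g)) all-P , λ g → P⊆xs g ∘ from (P⇔Q g)

hasCard-image : ∀ {m} {A : Set} {P : SPerm m → Set} (f : A → SPerm m) → (∀ {x y} → f x ≡ f y → x ≡ y) →
                (xs : List A) → Unique xs → (∀ g → P g ⇔ (∃ λ x → x ∈ₗ xs × g ≡ f x)) →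
                HasCard P (length xs)
hasCard-image f f-injective xs unique P⇔image =
  map f xs , length-map f xs , map⁺ f-injective unique ,
  All.tabulate (λ {g} g∈ → from (P⇔image g) (∈-map⁻ f g∈)) , λ g → in-image ∘ to (P⇔image g)
  where
  in-image : ∀ {g} → (∃ λ x → x ∈ₗ xs × g ≡ f x) → g ∈ₗ map f xs
  in-image (x , x∈ , refl) = ∈-map⁺ f x∈

-- Adm s a b singles out the signed swaps that are reflections of W.
data SwapIn {m} (Adm : Sign → Fin m → Fin m → Set) (S : Subset m) : SPerm m → Set where
  swapIn : ∀ {s a b} → Adm s a b → a ∈ S → b ∈ S → SwapIn Adm S (signedSwap s a b)

swapped-both : ∀ {m} {Q : SPerm m → Set} {R : Fin m → Set} {s} →
               (∀ {a b} → Q (signedSwap s a b) → R a) → ∀ {a b} → Q (signedSwap s a b) → R a × R b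
swapped-both {Q = Q} {s = s} R-first {a} {b} q = R-first q , R-first (subst Q (signedSwap-comm s a b) q)

signedSwap-moves : ∀ {m s} {a b : Fin m} → Reflecting s a b → row (signedSwap s a b) a ≢ (a , plus)
signedSwap-moves {s = s} {a} {b} reflecting row≡ =
  contradiction (trans (sym (,-injectiveʳ b,s≡a,plus)) (reflecting (sym (,-injectiveˡ b,s≡a,plus)))) λ ()
  where
  b,s≡a,plus : (b , s) ≡ (a , plus)
  b,s≡a,plus = trans (sym row-signedSwap-a) row≡

module _ {m} {Adm : Sign → Fin m → Fin m → Set}
         (Adm-sym : ∀ {s a b} → Adm s a b → Adm s b a)
         (Adm⇒Reflecting : ∀ {s a b} → Adm s a b → Reflecting s a b) where

  SwapIn-moved∈ : ∀ {S g j} → SwapIn Adm S g → row g j ≢ (j , plus) → j ∈ S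
  SwapIn-moved∈ {j = j} (swapIn {a = a} {b} _ a∈S b∈S) moves with j ≟ a | j ≟ b
  ... | yes refl | _        = a∈S
  ... | no _     | yes refl = b∈S
  ... | no j≢a   | no j≢b   = contradiction (row-signedSwap-other j≢a j≢b) moves

  module _ {p q : Subset m} (p⋖q : p ⋖ q) where
    open _⋖_ p⋖q

    new-swap⁻ : ∀ {g} → SwapIn Adm q g → ¬ SwapIn Adm p g →
                ∃₂ λ b s → (Adm s new b × b ∈ q) × g ≡ signedSwap s new b
    new-swap⁻ (swapIn {s} {a} {b} adm a∈q b∈q) ∉p with a ≟ new | b ≟ new
    ... | yes refl | _        = b , s , (adm , b∈q) , refl
    ... | no _     | yes refl = a , s , (Adm-sym adm , a∈q) , signedSwap-comm s a b
    ... | no a≢new | no b≢new = contradiction (swapIn adm (old a∈q a≢new) (old b∈q b≢new)) ∉p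

    new-swap⁺ : ∀ {b s} → Adm s new b → b ∈ q →
                SwapIn Adm q (signedSwap s new b) × ¬ SwapIn Adm p (signedSwap s new b)
    new-swap⁺ adm b∈q =
      swapIn adm new∈q b∈q , λ in-p → new∉p (SwapIn-moved∈ in-p (signedSwap-moves (Adm⇒Reflecting adm)))

    hasCard-new-swaps : (xs : List (Fin m × Sign)) → Unique xs →
                        (∀ {b s} → (b , s) ∈ₗ xs ⇔ (Adm s new b × b ∈ q)) →
                        HasCard (λ g → SwapIn Adm q g × ¬ SwapIn Adm p g) (length xs)
    hasCard-new-swaps xs unique ∈xs⇔ = hasCard-image (λ (b , s) → signedSwap s new b) injective xs unique
      λ g → mk⇔ (λ (in-q , ∉p) → indexed (new-swap⁻ in-q ∉p)) listed
      where
      injective : ∀ {x y} → signedSwap (proj₂ x) new (proj₁ x) ≡ signedSwap (proj₂ y) new (proj₁ y) → x ≡ y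
      injective eq = trans (sym row-signedSwap-a) (trans (cong (λ g → row g new) eq) row-signedSwap-a)
      indexed : ∀ {g} → (∃₂ λ b s → (Adm s new b × b ∈ q) × g ≡ signedSwap s new b) →
                ∃ λ x → x ∈ₗ xs × g ≡ signedSwap (proj₂ x) new (proj₁ x)
      indexed (b , s , adm∧b∈q , g≡) = (b , s) , from ∈xs⇔ adm∧b∈q , g≡
      listed : ∀ {g} → (∃ λ x → x ∈ₗ xs × g ≡ signedSwap (proj₂ x) new (proj₁ x)) →
               SwapIn Adm q g × ¬ SwapIn Adm p g
      listed (_ , x∈ , refl) = uncurry new-swap⁺ (to ∈xs⇔ x∈)

-- The simplex

Transposition : ∀ {m} → Sign → Fin m → Fin m → Set
Transposition s a b = s ≡ plus × a ≢ b

module _ {m} {S : Subset m} {a b : Fin m} where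

  private
    τ : Fin m → Fin m
    τ = lookup (σ (signedSwap plus a b))

  ε-transposition : ∀ j → lookup (ε (signedSwap plus a b)) j ≡ plus
  ε-transposition = signedSwap-elim (λ _ r → proj₂ r ≡ plus) refl refl λ _ _ _ → refl

  act-transposition-vertex : ∀ {x d} → (∀ j → x j ≡ e d j) →
                             ∀ j → act (signedSwap plus a b) x j ≡ e (τ d) j
  act-transposition-vertex {x} {d} x≗ed j = begin
    sgn (lookup (ε (signedSwap plus a b)) j) * x (τ j) ≡⟨ cong (λ t → sgn t * x (τ j)) (ε-transposition j) ⟩
    1ℤ * x (τ j)                                       ≡⟨ ℤ.*-identityˡ (x (τ j)) ⟩
    x (τ j)                                            ≡⟨ x≗ed (τ j) ⟩
    e d (τ j)                                          ≡⟨ e-involution (σ-signedSwap-involutive plus a b) d j ⟩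
    e (τ d) j                                          ∎

  transposition∈T : a ∈ S → b ∈ S → a ≢ b → T InA (SimplexVert S) (signedSwap plus a b)
  transposition∈T a∈S b∈S a≢b =
    (signedSwap-isPerm plus a b , ε-transposition) , transposition-isReflection plus a≢b , stabilises , moves
    where
    τ-preserves : ∀ d → d ∈ S → τ d ∈ S
    τ-preserves = signedSwap-elim (λ d r → d ∈ S → proj₁ r ∈ S) (λ _ → b∈S) (λ _ → a∈S) λ _ _ _ d∈S → d∈S
    stabilises : Stabilises (SimplexVert S) (signedSwap plus a b)
    stabilises x (d , d∈S , x≗ed) = τ d , τ-preserves d d∈S , act-transposition-vertex x≗ed
    moves : ActsNontrivially (SimplexVert S) (signedSwap plus a b)
    moves = e a , (a , a∈S , λ _ → refl) , a , λ gea≡ea → contradiction (begin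
      0ℤ                                ≡⟨ e-offdiag a≢b ⟨
      e b a                             ≡⟨ cong (λ i → e i a) (cong proj₁ row-signedSwap-a) ⟨
      e (τ a) a                         ≡⟨ act-transposition-vertex (λ _ → refl) a ⟨
      act (signedSwap plus a b) (e a) a ≡⟨ gea≡ea ⟩
      e a a                             ≡⟨ e-diag a ⟩
      1ℤ                                ∎) λ ()

  -- The moved vertex e_d has d ∈ {a, b}, and its image e_(τ d) is again a vertex of S.
  T-transposition⇒∈ : T InA (SimplexVert S) (signedSwap plus a b) → a ∈ S
  T-transposition⇒∈ (_ , _ , stabilises , (x , (d , d∈S , x≗ed) , j , gxj≢xj)) =
    signedSwap-elim (λ d r → d ∈ S → proj₁ r ∈ S → proj₁ r ≢ d → a ∈ S)
      (λ a∈S _ _ → a∈S) (λ _ a∈S _ → a∈S) (λ _ _ _ _ _ d≢d → contradiction refl d≢d) d d∈S τd∈S τd≢d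
    where
    τd∈S : τ d ∈ S
    τd∈S with stabilises x (d , d∈S , x≗ed)
    ... | d′ , d′∈S , gx≗ed′ =
      subst (_∈ S) (sym (e-injective λ i → trans (sym (act-transposition-vertex x≗ed i)) (gx≗ed′ i))) d′∈S
    τd≢d : τ d ≢ d
    τd≢d τd≡d = gxj≢xj (begin
      act (signedSwap plus a b) x j ≡⟨ act-transposition-vertex x≗ed j ⟩
      e (τ d) j                     ≡⟨ cong (λ i → e i j) τd≡d ⟩
      e d j                         ≡⟨ x≗ed j ⟨
      x j                           ∎)

T-simplex⇔ : ∀ {m} {S : Subset m} g → T InA (SimplexVert S) g ⇔ SwapIn Transposition S g
T-simplex⇔ {S = S} g = mk⇔ to-swap from-swap
  where
  unsigned-swapIn : ∀ {s a b} → s ≡ plus → Reflecting s a b → T InA (SimplexVert S) (signedSwap s a b) →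
                    SwapIn Transposition S (signedSwap s a b)
  unsigned-swapIn refl reflecting t = uncurry (swapIn (refl , λ a≡b → contradiction (reflecting a≡b) λ ()))
                                              (swapped-both {Q = T InA (SimplexVert S)} T-transposition⇒∈ t)
  -- The classification is consumed as an argument: a `with` on it would normalise its proof term.
  classified : ∀ {g} → (∃ λ s → ∃₂ λ a b → Reflecting s a b × g ≡ signedSwap s a b) →
               T InA (SimplexVert S) g → SwapIn Transposition S g
  classified (s , a , b , reflecting , refl) t@((_ , unsigned) , _) =
    unsigned-swapIn (trans (sym (cong proj₂ (row-signedSwap-a {s = s} {a} {b}))) (unsigned a)) reflecting t
  to-swap : T InA (SimplexVert S) g → SwapIn Transposition S g
  to-swap t@((perm , _) , isReflection , _) = classified (reflection-classification perm isReflection) t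
  from-swap : SwapIn Transposition S g → T InA (SimplexVert S) g
  from-swap (swapIn (refl , a≢b) a∈S b∈S) = transposition∈T a∈S b∈S a≢b

-- The cube

IsUnit : ℤ → Set
IsUnit y = y ≡ 1ℤ ⊎ y ≡ -1ℤ

sgn-isUnit : ∀ s → IsUnit (sgn s)
sgn-isUnit plus  = inj₁ refl
sgn-isUnit minus = inj₂ refl

isUnit-sgn* : ∀ s {y} → IsUnit y → IsUnit (sgn s * y)
isUnit-sgn* plus  (inj₁ refl) = inj₁ refl
isUnit-sgn* plus  (inj₂ refl) = inj₂ refl
isUnit-sgn* minus (inj₁ refl) = inj₂ refl
isUnit-sgn* minus (inj₂ refl) = inj₁ refl

sgn-opposite≢ : ∀ t → sgn (opposite t) ≢ sgn t
sgn-opposite≢ plus  ()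
sgn-opposite≢ minus ()

sgn*sgn-opposite≢ : ∀ s t → sgn s * sgn (opposite (s ⊛ t)) ≢ sgn t
sgn*sgn-opposite≢ plus  plus  ()
sgn*sgn-opposite≢ plus  minus ()
sgn*sgn-opposite≢ minus plus  ()
sgn*sgn-opposite≢ minus minus ()

sgn*-transpose : ∀ s t u → sgn s * sgn u ≡ sgn t → sgn s * sgn t ≡ sgn u
sgn*-transpose plus  plus  plus  _ = refl
sgn*-transpose plus  minus minus _ = refl
sgn*-transpose minus plus  minus _ = refl
sgn*-transpose minus minus plus  _ = refl

isFree : CubeCoord → Bool
isFree free    = inside
isFree (fix _) = outside

freeSet : ∀ {n} → CubeFace n → Subset n
freeSet G = tabulate (isFree ∘ G)

∈freeSet⇔ : ∀ {n} {G : CubeFace n} {j} → j ∈ freeSet G ⇔ G j ≡ free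
∈freeSet⇔ {G = G} {j} = mk⇔
  (isFree≡inside ∘ trans (sym (lookup∘tabulate (isFree ∘ G) j)) ∘ []=⇒lookup)
  (λ Gj≡free → lookup⇒[]= j (freeSet G) (trans (lookup∘tabulate (isFree ∘ G) j) (cong isFree Gj≡free)))
  where
  isFree≡inside : ∀ {c} → isFree c ≡ inside → c ≡ free
  isFree≡inside {free} _ = refl

numFree≡∣freeSet∣ : ∀ {n} (G : CubeFace n) → numFree G ≡ ∣ freeSet G ∣
numFree≡∣freeSet∣ {zero}  G = refl
numFree≡∣freeSet∣ {suc n} G with G zero
... | free  = cong suc (numFree≡∣freeSet∣ (G ∘ suc))
... | fix _ = numFree≡∣freeSet∣ (G ∘ suc)

coordinate : CubeCoord → Sign → ℤ
coordinate free    s = sgn s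
coordinate (fix t) _ = sgn t

vertex : ∀ {n} → CubeFace n → (Fin n → Sign) → Pt n
vertex G u j = coordinate (G j) (u j)

vertex-isVertex : ∀ {n} (G : CubeFace n) u → CubeVert G (vertex G u)
vertex-isVertex G u j = legal (G j) (u j)
  where
  legal : ∀ c s → IsUnit (coordinate c s) × (∀ t → c ≡ fix t → coordinate c s ≡ sgn t)
  legal free    s = sgn-isUnit s , λ _ ()
  legal (fix t) _ = sgn-isUnit t , λ { _ refl → refl }

vertex-free : ∀ {n} (G : CubeFace n) u {j} → G j ≡ free → vertex G u j ≡ sgn (u j)
vertex-free G u {j} Gj≡free = cong (λ c → coordinate c (u j)) Gj≡free

signedSwap-moves-vertex : ∀ {n} {G : CubeFace n} {s} {a b : Fin n} →
                          Reflecting s a b → G a ≡ free → G b ≡ free →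
                          ActsNontrivially (CubeVert G) (signedSwap s a b)
signedSwap-moves-vertex {G = G} {minus} {a} {b} _ Ga Gb =
  vertex G u , vertex-isVertex G u , a ,
  λ gxa≡xa → contradiction (trans (sym gxa≡-1) (trans gxa≡xa (vertex-free G u Ga))) λ ()
  where
  u : Fin _ → Sign
  u _ = plus
  gxa≡-1 : act (signedSwap minus a b) (vertex G u) a ≡ -1ℤ
  gxa≡-1 = trans (act-row (signedSwap minus a b) (vertex G u) row-signedSwap-a)
                 (cong (-1ℤ *_) (vertex-free G u Gb))
signedSwap-moves-vertex {G = G} {plus} {a} {b} reflecting Ga Gb =
  vertex G u , vertex-isVertex G u , a ,
  λ gxa≡xa → contradiction (trans (sym gxa≡-1) (trans gxa≡xa xa≡1)) λ ()
  where
  u : Fin _ → Sign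
  u = updateAt (λ _ → plus) b (λ _ → minus)
  gxa≡-1 : act (signedSwap plus a b) (vertex G u) a ≡ -1ℤ
  gxa≡-1 = trans (act-row (signedSwap plus a b) (vertex G u) row-signedSwap-a)
                 (cong (1ℤ *_) (trans (vertex-free G u Gb) (cong sgn (updateAt-updates b _))))
  xa≡1 : vertex G u a ≡ 1ℤ
  xa≡1 = trans (vertex-free G u Ga) (cong sgn (updateAt-minimal a b _ λ a≡b → contradiction (reflecting a≡b) λ ()))

signedSwap∈T : ∀ {n} {G : CubeFace n} {s} {a b : Fin n} → Reflecting s a b → G a ≡ free → G b ≡ free →
               T InB (CubeVert G) (signedSwap s a b)
signedSwap∈T {G = G} {s} {a} {b} reflecting Ga Gb =
  signedSwap-isPerm s a b , signedSwap-isReflection reflecting , stabilises , signedSwap-moves-vertex reflecting Ga Gb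
  where
  Legal : Fin _ → ℤ → Set
  Legal j y = IsUnit y × (∀ t → G j ≡ fix t → y ≡ sgn t)
  unconstrained : ∀ {j y} → G j ≡ free → ∀ t → G j ≡ fix t → y ≡ sgn t
  unconstrained Gj≡free t Gj≡fix = contradiction (trans (sym Gj≡free) Gj≡fix) λ ()
  stabilises : Stabilises (CubeVert G) (signedSwap s a b)
  stabilises x x∈ = signedSwap-elim (λ j (i , t) → Legal j (sgn t * x i))
    (isUnit-sgn* s (proj₁ (x∈ b)) , λ t → unconstrained Ga t)
    (isUnit-sgn* s (proj₁ (x∈ a)) , λ t → unconstrained Gb t)
    (λ j _ _ → subst (Legal j) (sym (ℤ.*-identityˡ (x j))) (x∈ j))

T-signedSwap⇒free : ∀ {n} {G : CubeFace n} {s} {a b : Fin n} → T InB (CubeVert G) (signedSwap s a b) → G a ≡ free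
T-signedSwap⇒free {G = G} {s} {a} {b} (_ , _ , stabilises , (x , x∈ , j , gxj≢xj)) with G a in Ga | G b in Gb
... | free  | _     = refl
-- A vertex with x_b = −s·t would be sent off the face x_a = t.
... | fix t | free  = contradiction (proj₂ (stabilises y (vertex-isVertex G u) a) t Ga) gya≢t
  where
  u : Fin _ → Sign
  u _ = opposite (s ⊛ t)
  y : Pt _
  y = vertex G u
  gya≢t : act (signedSwap s a b) y a ≢ sgn t
  gya≢t gya≡t = sgn*sgn-opposite≢ s t (begin
    sgn s * sgn (opposite (s ⊛ t)) ≡⟨ cong (sgn s *_) (vertex-free G u Gb) ⟨
    sgn s * y b                    ≡⟨ act-row (signedSwap s a b) y row-signedSwap-a ⟨
    act (signedSwap s a b) y a     ≡⟨ gya≡t ⟩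
    sgn t                          ∎)
-- Stability forces s·t₂ = t, and then g fixes every vertex.
... | fix t | fix t₂ = contradiction (fixes j) gxj≢xj
  where
  xa≡t : x a ≡ sgn t
  xa≡t = proj₂ (x∈ a) t Ga
  xb≡t₂ : x b ≡ sgn t₂
  xb≡t₂ = proj₂ (x∈ b) t₂ Gb
  st₂≡t : sgn s * sgn t₂ ≡ sgn t
  st₂≡t = begin
    sgn s * sgn t₂             ≡⟨ cong (sgn s *_) xb≡t₂ ⟨
    sgn s * x b                ≡⟨ act-row (signedSwap s a b) x row-signedSwap-a ⟨
    act (signedSwap s a b) x a ≡⟨ proj₂ (stabilises x x∈ a) t Ga ⟩
    sgn t                      ∎
  fixes : ∀ j → act (signedSwap s a b) x j ≡ x j
  fixes = signedSwap-elim (λ j (i , t) → sgn t * x i ≡ x j)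
    (trans (cong (sgn s *_) xb≡t₂) (trans st₂≡t (sym xa≡t)))
    (trans (cong (sgn s *_) xa≡t) (trans (sgn*-transpose s t t₂ st₂≡t) (sym xb≡t₂)))
    (λ j _ _ → ℤ.*-identityˡ (x j))

T-cube⇔ : ∀ {n} {G : CubeFace n} g → T InB (CubeVert G) g ⇔ SwapIn Reflecting (freeSet G) g
T-cube⇔ {G = G} g = mk⇔ to-swap from-swap
  where
  classified : ∀ {g} → (∃ λ s → ∃₂ λ a b → Reflecting s a b × g ≡ signedSwap s a b) →
               T InB (CubeVert G) g → SwapIn Reflecting (freeSet G) g
  classified (s , a , b , reflecting , refl) t =
    uncurry (swapIn reflecting) (swapped-both {Q = T InB (CubeVert G)} (from ∈freeSet⇔ ∘ T-signedSwap⇒free) t)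
  to-swap : T InB (CubeVert G) g → SwapIn Reflecting (freeSet G) g
  to-swap t@(perm , isReflection , _) = classified (reflection-classification perm isReflection) t
  from-swap : SwapIn Reflecting (freeSet G) g → T InB (CubeVert G) g
  from-swap (swapIn reflecting a∈ b∈) = signedSwap∈T reflecting (to ∈freeSet⇔ a∈) (to ∈freeSet⇔ b∈)

SimplexVert-⊆ : ∀ {m} {p q : Subset m} → (∀ x → SimplexVert p x → SimplexVert q x) → p ⊆ q
SimplexVert-⊆ {q = q} vertices⊆ {a} a∈p with vertices⊆ (e a) (a , a∈p , λ _ → refl)
... | a′ , a′∈q , ea≗ea′ = subst (_∈ q) (sym (e-injective ea≗ea′)) a′∈q

CubeVert-⊆ : ∀ {n} {G₀ G₁ : CubeFace n} → (∀ x → CubeVert G₀ x → CubeVert G₁ x) → freeSet G₀ ⊆ freeSet G₁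
CubeVert-⊆ {G₀ = G₀} {G₁} vertices⊆ {j} j∈ = from ∈freeSet⇔ (free-mono (to ∈freeSet⇔ j∈))
  where
  free-mono : G₀ j ≡ free → G₁ j ≡ free
  free-mono G₀j with G₁ j in G₁j
  ... | free  = refl
  ... | fix t = contradiction (trans (sym (vertex-free G₀ u G₀j)) (proj₂ (G₁-vertex j) t G₁j)) (sgn-opposite≢ t)
    where
    u : Fin _ → Sign
    u _ = opposite t
    G₁-vertex : CubeVert G₁ (vertex G₀ u)
    G₁-vertex = vertices⊆ (vertex G₀ u) (vertex-isVertex G₀ u)

simplex-step : ∀ {m} {p q : Subset m} → p ⋖ q →
               HasCard (λ g → T InA (SimplexVert q) g × ¬ T InA (SimplexVert p) g) ∣ p ∣
simplex-step {p = p} {q} p⋖q =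
  HasCard-cong (λ g → ⇔-sym (T-simplex⇔ g ×-⇔ ¬-cong-⇔ (T-simplex⇔ g)))
    (subst (HasCard _) (length-tagged p plus)
      (hasCard-new-swaps Transposition-sym Transposition⇒Reflecting p⋖q (tagged plus p) (tagged-unique p plus) index⇔))
  where
  open _⋖_ p⋖q
  Transposition-sym : ∀ {s a b} → Transposition s a b → Transposition s b a
  Transposition-sym (s≡plus , a≢b) = s≡plus , a≢b ∘ sym
  Transposition⇒Reflecting : ∀ {s a b} → Transposition s a b → Reflecting s a b
  Transposition⇒Reflecting (_ , a≢b) a≡b = contradiction a≡b a≢b
  index⇔ : ∀ {b s} → (b , s) ∈ₗ tagged plus p ⇔ (Transposition s new b × b ∈ q)
  index⇔ = mk⇔
    (λ x∈ → let (s≡plus , b∈p) = to ∈-tagged⇔ x∈ in (s≡plus , new≢ b∈p) , p⊆q b∈p)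
    (λ ((s≡plus , new≢b) , b∈q) → from ∈-tagged⇔ (s≡plus , old b∈q (new≢b ∘ sym)))

cube-step : ∀ {n} {G₀ G₁ : CubeFace n} → freeSet G₀ ⋖ freeSet G₁ →
            HasCard (λ g → T InB (CubeVert G₁) g × ¬ T InB (CubeVert G₀) g)
                    (∣ freeSet G₁ ∣ ℕ.+ ∣ freeSet G₀ ∣)
cube-step {G₀ = G₀} {G₁} p⋖q =
  HasCard-cong (λ g → ⇔-sym (T-cube⇔ g ×-⇔ ¬-cong-⇔ (T-cube⇔ g)))
    (subst (HasCard _) (trans (length-++ xs₋) (cong₂ ℕ._+_ (length-tagged q minus) (length-tagged p plus)))
      (hasCard-new-swaps (λ r b≡a → r (sym b≡a)) (λ r → r) p⋖q (xs₋ ++ xs₊) unique index⇔))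
  where
  open _⋖_ p⋖q
  p q : Subset _
  p = freeSet G₀
  q = freeSet G₁
  xs₋ xs₊ : List (Fin _ × Sign)
  xs₋ = tagged minus q
  xs₊ = tagged plus p
  unique : Unique (xs₋ ++ xs₊)
  unique = ++⁺ (tagged-unique q minus) (tagged-unique p plus)
    λ (x∈₋ , x∈₊) → contradiction (trans (sym (proj₁ (to (∈-tagged⇔ {p = q}) x∈₋)))
                                         (proj₁ (to (∈-tagged⇔ {p = p}) x∈₊))) λ ()
  index⇔ : ∀ {b s} → (b , s) ∈ₗ xs₋ ++ xs₊ ⇔ (Reflecting s new b × b ∈ q)
  index⇔ = mk⇔ (λ x∈ → [ negative , positive ]′ (∈-++⁻ xs₋ x∈)) (uncurry (listed _))
    where
    negative : ∀ {b s} → (b , s) ∈ₗ xs₋ → Reflecting s new b × b ∈ q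
    negative x∈ = let (s≡minus , b∈q) = to ∈-tagged⇔ x∈ in (λ _ → s≡minus) , b∈q
    positive : ∀ {b s} → (b , s) ∈ₗ xs₊ → Reflecting s new b × b ∈ q
    positive x∈ = let (_ , b∈p) = to ∈-tagged⇔ x∈ in (λ new≡b → contradiction new≡b (new≢ b∈p)) , p⊆q b∈p
    listed : ∀ s {b} → Reflecting s new b → b ∈ q → (b , s) ∈ₗ xs₋ ++ xs₊
    listed minus _          b∈q = ∈-++⁺ˡ (from ∈-tagged⇔ (refl , b∈q))
    listed plus  reflecting b∈q =
      ∈-++⁺ʳ xs₋ (from ∈-tagged⇔ (refl , old b∈q λ b≡new → contradiction (reflecting (sym b≡new)) λ ()))

simplex-flag-step : ∀ (n : ℕ) (F : Fin (suc n) → Subset (suc n)) → IsSimplexFlag n F → ∀ (k : Fin n) →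
  HasCard (λ g → T InA (SimplexVert (F (suc k))) g × ¬ T InA (SimplexVert (F (inject₁ k))) g)
          (degA (suc (toℕ k)) ∸ 1)
simplex-flag-step n F (dims , nested) k =
  subst (HasCard _) (trans ∣F₀∣≡1+k (ℕ.+-comm 1 (toℕ k)))
    (simplex-step (⊆∧∣q∣≡1+∣p∣⇒⋖ (SimplexVert-⊆ (nested k)) (trans (dims (suc k)) (cong suc (sym ∣F₀∣≡1+k)))))
  where
  ∣F₀∣≡1+k : ∣ F (inject₁ k) ∣ ≡ suc (toℕ k)
  ∣F₀∣≡1+k = trans (dims (inject₁ k)) (cong suc (toℕ-inject₁ k))

cube-flag-step : ∀ (n : ℕ) (F : Fin (suc n) → CubeFace n) → IsCubeFlag n F → ∀ (k : Fin n) →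
  HasCard (λ g → T InB (CubeVert (F (suc k))) g × ¬ T InB (CubeVert (F (inject₁ k))) g)
          (degB (suc (toℕ k)) ∸ 1)
cube-flag-step n F (dims , nested) k =
  subst (HasCard _) (trans (cong₂ ℕ._+_ ∣G₁∣≡1+k ∣G₀∣≡k) (1+t+t≡2[1+t]∸1 (toℕ k)))
    (cube-step (⊆∧∣q∣≡1+∣p∣⇒⋖ (CubeVert-⊆ (nested k)) (trans ∣G₁∣≡1+k (cong suc (sym ∣G₀∣≡k)))))
  where
  ∣G₀∣≡k : ∣ freeSet (F (inject₁ k)) ∣ ≡ toℕ k
  ∣G₀∣≡k = trans (sym (numFree≡∣freeSet∣ (F (inject₁ k)))) (trans (dims (inject₁ k)) (toℕ-inject₁ k))
  ∣G₁∣≡1+k : ∣ freeSet (F (suc k)) ∣ ≡ suc (toℕ k)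
  ∣G₁∣≡1+k = trans (sym (numFree≡∣freeSet∣ (F (suc k)))) (dims (suc k))
  1+t+t≡2[1+t]∸1 : ∀ t → suc t ℕ.+ t ≡ degB (suc t) ∸ 1
  1+t+t≡2[1+t]∸1 t = sym (trans (ℕ.+-suc t (t ℕ.+ 0)) (cong (λ u → suc (t ℕ.+ u)) (ℕ.+-identityʳ t)))

lemma4p1 :
    (∀ (n : ℕ) (F : Fin (suc n) → Subset (suc n)) → IsSimplexFlag n F →
       ∀ (k : Fin n) →
         HasCard (λ g → T InA (SimplexVert (F (suc k))) g × ¬ T InA (SimplexVert (F (inject₁ k))) g)
                 (degA (suc (toℕ k)) ∸ 1))
    ×
    (∀ (n : ℕ) (F : Fin (suc n) → CubeFace n) → IsCubeFlag n F →
       ∀ (k : Fin n) →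
         HasCard (λ g → T InB (CubeVert (F (suc k))) g × ¬ T InB (CubeVert (F (inject₁ k))) g)
                 (degB (suc (toℕ k)) ∸ 1))
lemma4p1 = simplex-flag-step , cube-flag-step
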